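{- Let $n,m$ be positive integers with $n\ge 7$ and $m\le 9$. If every $3$-uniform bi-hypergraph with $n$ vertices and $m$ edges is colorable, then every $3$-uniform bi-hypergraph with $n+1$ vertices and $m$ edges is colorable.
   Context: A bi-hypergraph is a pair $\mathcal{H}=(\mathcal{V},\mathcal{E})$ with $\mathcal{V}$ a finite set and $\mathcal{E}$ a Sperner family of subsets of $\mathcal{V}$ (edges); it is $3$-uniform if all edges have size $3$. A proper coloring is a map $f:\mathcal{V}\to\mathbb{N}$ with $1<|\{f(v):v\in e\}|<|e|$ for every edge $e$; $\mathcal{H}$ is colorable if such $f$ exists. -}

module Defs where

open import Data.Nat using (ℕ; _≤_)
open import Data.Fin using (Fin)
open import Data.Fin.Subset using (Subset; _∈_; _⊆_; ∣_∣)
open import Data.Product using (Σ; ∃; _×_)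
open import Relation.Binary.PropositionalEquality using (_≡_; _≢_)
open import Relation.Nullary using (¬_)

-- Edges are indexed by Fin m; the Sperner condition (no edge contained in
-- a different edge) in particular forces the m edges to be distinct.
record BiHypergraph3 (n m : ℕ) : Set where
  field
    edge     : Fin m → Subset n
    uniform  : ∀ i → ∣ edge i ∣ ≡ 3
    sperner  : ∀ i j → i ≢ j → ¬ (edge i ⊆ edge j)

open BiHypergraph3 public

-- |{f v : v ∈ e}| > 1 : f is not constant on e
NonConstantOn : {n : ℕ} → (Fin n → ℕ) → Subset n → Set
NonConstantOn f e = ∃ λ u → ∃ λ v → u ∈ e × v ∈ e × f u ≢ f v

-- |{f v : v ∈ e}| < |e| : f is not injective on e
NonInjectiveOn : {n : ℕ} → (Fin n → ℕ) → Subset n → Set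
NonInjectiveOn f e = ∃ λ u → ∃ λ v → u ∈ e × v ∈ e × u ≢ v × f u ≡ f v

ProperColoring : {n m : ℕ} → BiHypergraph3 n m → (Fin n → ℕ) → Set
ProperColoring H f = ∀ i → NonConstantOn f (edge H i) × NonInjectiveOn f (edge H i)

Colorable : {n m : ℕ} → BiHypergraph3 n m → Set
Colorable {n} H = Σ (Fin n → ℕ) λ f → ProperColoring H f

module Submission where

-- The 3m ≤ 27 edges of H contain at most 27 of the 28 pairs among its first eight
-- vertices, so two distinct vertices w, x lie in no common edge.  Merging x into w is
-- then injective on every edge, so the edges map to 3-sets on n vertices.  These may
-- coincide; padding them with further 3-sets (seven vertices carry enough) gives m
-- distinct 3-sets, a bi-hypergraph H′ since distinct 3-sets never contain one another.
-- Each edge of H maps onto an edge of H′, so a proper colouring of H′ composed with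
-- the merge is a proper colouring of H.

open import Defs
open import Data.Bool.Properties using () renaming (_≟_ to _≟ᵇ_)
open import Data.Fin using (Fin; zero; suc; punchOut; _↑ˡ_; _<?_)
open import Data.Fin.Properties using (injective⇒≤; suc-injective; punchOut-injective; any?; ↑ˡ-injective)
  renaming (_≟_ to _≟ᶠ_; <⇒≢ to <⇒≢ᶠ)
open import Data.Fin.Subset using (Subset; ⁅_⁆; _∪_; _∈_; _∉_; _⊆_; ∣_∣; inside; outside)
open import Data.Fin.Subset.Properties
  using (_∈?_; ∪-comm; ∪-identityˡ; ⊆-antisym; p⊂q⇒∣p∣<∣q∣; x∈⁅x⁆; x∈⁅y⁆⇒x≡y; x≢y⇒x∉⁅y⁆; ∣⁅x⁆∣≡1; x∈p∪q⁻; x∈p∪q⁺)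
open import Data.List using (List; []; _∷_; length; lookup; map; concatMap; allFin; filter; cartesianProduct)
open import Data.List.Properties using (length-map; length-tabulate; length-deduplicate)
open import Data.List.Membership.Propositional using (find) renaming (_∈_ to _∈ₗ_; _∉_ to _∉ₗ_)
import Data.List.Membership.DecPropositional as DecMembership
open import Data.List.Membership.Propositional.Properties
  using (∈-lookup; ∈-map⁺; ∈-map⁻; ∈-allFin; ∈-tabulate⁺; ∈-concat⁺′; ∈-filter⁻; ∈-deduplicate⁺)
open import Data.List.Relation.Unary.Any as Any using (here; there)
open import Data.List.Relation.Unary.Any.Properties using (lookup-index)
open import Data.List.Relation.Unary.All as All using (All; []; _∷_; all?)
open import Data.List.Relation.Unary.All.Properties using (¬All⇒Any¬; ¬Any⇒All¬; deduplicate⁺; tabulate⁺)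
open import Data.List.Relation.Unary.AllPairs using ([]; _∷_)
open import Data.List.Relation.Unary.Unique.Propositional using (Unique)
open import Data.List.Relation.Unary.Unique.Propositional.Properties using (map⁺; map⁻)
open import Data.List.Relation.Unary.Unique.DecPropositional.Properties using (deduplicate-!)
import Data.List.Relation.Unary.Unique.DecPropositional as DecUnique
open import Data.Nat using (ℕ; zero; suc; _+_; _*_; _≤_; _<_; s≤s)
open import Data.Nat.Properties
  using (<⇒≢; <⇒≱; ≤-trans; ≤-reflexive; +-suc; +-identityʳ; *-suc; *-monoʳ-≤; m≤m+n; m≤n⇒∃[o]m+o≡n)
open import Data.Product as Product using (Σ; ∃; _×_; _,_; proj₂; uncurry)
open import Data.Sum using (_⊎_; inj₁; inj₂)
open import Data.Vec using ([]; _∷_; here; there; take)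
open import Data.Vec.Properties using (≡-dec; ∷-injectiveʳ)
open import Function using (_∘_; Injective)
open import Relation.Binary.Definitions using (DecidableEquality)
open import Relation.Binary.PropositionalEquality
open import Relation.Nullary using (¬_; Dec; yes; no; contradiction; _×-dec_)
open import Relation.Nullary.Decidable using (True; toWitness)

private variable
  n m : ℕ

module _ {A : Set} where

  Unique⇒lookup-injective : ∀ {xs : List A} → Unique xs → Injective _≡_ _≡_ (lookup xs)
  Unique⇒lookup-injective {x ∷ xs} (x∉ ∷ u) {zero}  {zero}  eq = refl
  Unique⇒lookup-injective {x ∷ xs} (x∉ ∷ u) {zero}  {suc j} eq = contradiction eq (All.lookup x∉ (∈-lookup j))
  Unique⇒lookup-injective {x ∷ xs} (x∉ ∷ u) {suc i} {zero}  eq = contradiction (sym eq) (All.lookup x∉ (∈-lookup i))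
  Unique⇒lookup-injective {x ∷ xs} (x∉ ∷ u) {suc i} {suc j} eq = cong suc (Unique⇒lookup-injective u eq)

  Unique∧⊆⇒length≤ : ∀ {xs ys : List A} → Unique xs → (∀ {z} → z ∈ₗ xs → z ∈ₗ ys) → length xs ≤ length ys
  Unique∧⊆⇒length≤ {xs} {ys} u xs⊆ys = injective⇒≤ {f = position} position-injective
    where
    position : Fin (length xs) → Fin (length ys)
    position i = Any.index (xs⊆ys (∈-lookup i))
    position-injective : Injective _≡_ _≡_ position
    position-injective {i} {j} eq = Unique⇒lookup-injective u (begin
      lookup xs i            ≡⟨ lookup-index (xs⊆ys (∈-lookup i)) ⟩
      lookup ys (position i) ≡⟨ cong (lookup ys) eq ⟩
      lookup ys (position j) ≡⟨ lookup-index (xs⊆ys (∈-lookup j)) ⟨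
      lookup xs j            ∎)
      where open ≡-Reasoning

  enumerate : ∀ {m} (zs : List A) → length zs ≡ m → Unique zs →
    Σ (Fin m → A) λ f → Injective _≡_ _≡_ f × (∀ i → f i ∈ₗ zs) × (∀ {z} → z ∈ₗ zs → ∃ λ i → f i ≡ z)
  enumerate zs refl u = lookup zs , Unique⇒lookup-injective u , ∈-lookup , λ z∈ → Any.index z∈ , sym (lookup-index z∈)

  module _ (_≟_ : DecidableEquality A) where
    open DecMembership _≟_ using () renaming (_∈?_ to _∈ₗ?_)

    Unique∧length<⇒∃∉ : ∀ {xs pool : List A} → Unique pool → length xs < length pool →
      ∃ λ p → p ∈ₗ pool × p ∉ₗ xs
    Unique∧length<⇒∃∉ {xs} {pool} u xs<pool with all? (_∈ₗ? xs) pool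
    ... | yes pool⊆xs = contradiction (Unique∧⊆⇒length≤ u (All.lookup pool⊆xs)) (<⇒≱ xs<pool)
    ... | no  pool⊈xs = find (¬All⇒Any¬ (_∈ₗ? xs) pool pool⊈xs)

    module _ {P : A → Set} {pool : List A} (pool-unique : Unique pool) (pool-P : All P pool) where

      extendUnique : ∀ d {ys} → Unique ys → All P ys → length ys + d ≤ length pool →
        ∃ λ zs → Unique zs × All P zs × length zs ≡ length ys + d × (∀ {z} → z ∈ₗ ys → z ∈ₗ zs)
      extendUnique zero    {ys} u Pys _  = ys , u , Pys , sym (+-identityʳ _) , λ z∈ → z∈
      extendUnique (suc d) {ys} u Pys ys+1+d≤pool
        with 1+ys+d≤pool ← subst (_≤ length pool) (+-suc _ d) ys+1+d≤pool
        with p , p∈ , p∉ ← Unique∧length<⇒∃∉ pool-unique (≤-trans (s≤s (m≤m+n _ d)) 1+ys+d≤pool)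
        with zs , u′ , Pzs , len , ys⊆zs ← extendUnique d (¬Any⇒All¬ ys p∉ ∷ u) (All.lookup pool-P p∈ ∷ Pys) 1+ys+d≤pool
        = zs , u′ , Pzs , trans len (sym (+-suc _ d)) , λ z∈ → ys⊆zs (there z∈)

      injectiveFamily : ∀ {m xs} → All P xs → length xs ≤ m → m ≤ length pool →
        Σ (Fin m → A) λ f → Injective _≡_ _≡_ f × (∀ i → P (f i)) × (∀ {z} → z ∈ₗ xs → ∃ λ i → f i ≡ z)
      injectiveFamily {m} {xs} Pxs xs≤m m≤pool
        with d , ys+d≡m ← m≤n⇒∃[o]m+o≡n (≤-trans (length-deduplicate _≟_ xs) xs≤m)
        with zs , u , Pzs , len , ys⊆zs ← extendUnique d (deduplicate-! _≟_ xs) (deduplicate⁺ _≟_ Pxs)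
                                            (subst (_≤ length pool) (sym ys+d≡m) m≤pool)
        with f , f-injective , f∈zs , f-onto ← enumerate zs (trans len ys+d≡m) u
        = f , f-injective , (λ i → All.lookup Pzs (f∈zs i)) , λ z∈ → f-onto (ys⊆zs (∈-deduplicate⁺ _≟_ z∈))

pair : Fin n → Fin n → Subset n
pair a b = ⁅ a ⁆ ∪ ⁅ b ⁆

triple : Fin n → Fin n → Fin n → Subset n
triple a b c = ⁅ a ⁆ ∪ pair b c

pair-comm : ∀ (a b : Fin n) → pair a b ≡ pair b a
pair-comm a b = ∪-comm ⁅ a ⁆ ⁅ b ⁆

∣⁅x⁆∪p∣≡1+∣p∣ : ∀ (x : Fin n) p → x ∉ p → ∣ ⁅ x ⁆ ∪ p ∣ ≡ suc ∣ p ∣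
∣⁅x⁆∪p∣≡1+∣p∣ zero    (inside  ∷ p) x∉p = contradiction here x∉p
∣⁅x⁆∪p∣≡1+∣p∣ zero    (outside ∷ p) x∉p = cong (suc ∘ ∣_∣) (∪-identityˡ p)
∣⁅x⁆∪p∣≡1+∣p∣ (suc x) (inside  ∷ p) x∉p = cong suc (∣⁅x⁆∪p∣≡1+∣p∣ x p (x∉p ∘ there))
∣⁅x⁆∪p∣≡1+∣p∣ (suc x) (outside ∷ p) x∉p = ∣⁅x⁆∪p∣≡1+∣p∣ x p (x∉p ∘ there)

∈-pair⁻ : ∀ {x a b : Fin n} → x ∈ pair a b → x ≡ a ⊎ x ≡ b
∈-pair⁻ {a = a} {b} x∈ with x∈p∪q⁻ ⁅ a ⁆ ⁅ b ⁆ x∈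
... | inj₁ x∈a = inj₁ (x∈⁅y⁆⇒x≡y a x∈a)
... | inj₂ x∈b = inj₂ (x∈⁅y⁆⇒x≡y b x∈b)

∈-triple⁻ : ∀ {x a b c : Fin n} → x ∈ triple a b c → x ≡ a ⊎ x ≡ b ⊎ x ≡ c
∈-triple⁻ {a = a} {b} {c} x∈ with x∈p∪q⁻ ⁅ a ⁆ (pair b c) x∈
... | inj₁ x∈a  = inj₁ (x∈⁅y⁆⇒x≡y a x∈a)
... | inj₂ x∈bc = inj₂ (∈-pair⁻ x∈bc)

∈-triple⁺ : ∀ {x a b c : Fin n} → x ≡ a ⊎ x ≡ b ⊎ x ≡ c → x ∈ triple a b c
∈-triple⁺ {x = x} (inj₁ refl)        = x∈p∪q⁺ (inj₁ (x∈⁅x⁆ x))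
∈-triple⁺ {x = x} (inj₂ (inj₁ refl)) = x∈p∪q⁺ (inj₂ (x∈p∪q⁺ (inj₁ (x∈⁅x⁆ x))))
∈-triple⁺ {x = x} (inj₂ (inj₂ refl)) = x∈p∪q⁺ (inj₂ (x∈p∪q⁺ (inj₂ (x∈⁅x⁆ x))))

∣pair∣≡2 : ∀ {a b : Fin n} → a ≢ b → ∣ pair a b ∣ ≡ 2
∣pair∣≡2 {a = a} {b} a≢b = trans (∣⁅x⁆∪p∣≡1+∣p∣ a ⁅ b ⁆ (x≢y⇒x∉⁅y⁆ a≢b)) (cong suc (∣⁅x⁆∣≡1 b))

∣triple∣≡3 : ∀ {a b c : Fin n} → a ≢ b → a ≢ c → b ≢ c → ∣ triple a b c ∣ ≡ 3
∣triple∣≡3 {a = a} {b} {c} a≢b a≢c b≢c =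
  trans (∣⁅x⁆∪p∣≡1+∣p∣ a (pair b c) a∉bc) (cong suc (∣pair∣≡2 b≢c))
  where
  a∉bc : a ∉ pair b c
  a∉bc a∈ with ∈-pair⁻ a∈
  ... | inj₁ a≡b = a≢b a≡b
  ... | inj₂ a≡c = a≢c a≡c

⊆∧∣≡∣⇒≡ : ∀ {p q : Subset n} → p ⊆ q → ∣ p ∣ ≡ ∣ q ∣ → p ≡ q
⊆∧∣≡∣⇒≡ {p = p} {q} p⊆q ∣p∣≡∣q∣ = ⊆-antisym p⊆q q⊆p
  where
  q⊆p : q ⊆ p
  q⊆p {x} x∈q with x ∈? p
  ... | yes x∈p = x∈p
  ... | no  x∉p = contradiction ∣p∣≡∣q∣ (<⇒≢ (p⊂q⇒∣p∣<∣q∣ (p⊆q , x , x∈q , x∉p)))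

members : Subset n → List (Fin n)
members []            = []
members (inside  ∷ p) = zero ∷ map suc (members p)
members (outside ∷ p) = map suc (members p)

length-members : ∀ (p : Subset n) → length (members p) ≡ ∣ p ∣
length-members []            = refl
length-members (inside  ∷ p) = cong suc (trans (length-map suc (members p)) (length-members p))
length-members (outside ∷ p) = trans (length-map suc (members p)) (length-members p)

∈-members⁻ : ∀ (p : Subset n) {x} → x ∈ₗ members p → x ∈ p
∈-members⁻ (inside  ∷ p) (here refl) = here
∈-members⁻ (inside  ∷ p) (there x∈) with y , y∈ , refl ← ∈-map⁻ suc x∈ = there (∈-members⁻ p y∈)
∈-members⁻ (outside ∷ p) x∈         with y , y∈ , refl ← ∈-map⁻ suc x∈ = there (∈-members⁻ p y∈)

members-unique : ∀ (p : Subset n) → Unique (members p)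
members-unique []            = []
members-unique (inside  ∷ p) = All.tabulate zero∉ ∷ map⁺ suc-injective (members-unique p)
  where
  zero∉ : ∀ {x} → x ∈ₗ map suc (members p) → zero ≢ x
  zero∉ x∈ with _ , _ , refl ← ∈-map⁻ suc x∈ = λ ()
members-unique (outside ∷ p) = map⁺ suc-injective (members-unique p)

record IsTriple (p : Subset n) : Set where
  field
    a b c : Fin n
    a≢b   : a ≢ b
    a≢c   : a ≢ c
    b≢c   : b ≢ c
    p≡abc : p ≡ triple a b c

  ∈⁺ : ∀ {x} → x ≡ a ⊎ x ≡ b ⊎ x ≡ c → x ∈ p
  ∈⁺ x≡ = subst (_ ∈_) (sym p≡abc) (∈-triple⁺ x≡)

∣p∣≡3⇒IsTriple : ∀ (p : Subset n) → ∣ p ∣ ≡ 3 → IsTriple p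
∣p∣≡3⇒IsTriple p ∣p∣≡3 with members p | length-members p | members-unique p | ∈-members⁻ p
... | a ∷ b ∷ c ∷ [] | _ | (a≢b ∷ a≢c ∷ []) ∷ (b≢c ∷ []) ∷ _ | sound = record
  { a = a ; b = b ; c = c ; a≢b = a≢b ; a≢c = a≢c ; b≢c = b≢c
  ; p≡abc = sym (⊆∧∣≡∣⇒≡ abc⊆p (trans (∣triple∣≡3 a≢b a≢c b≢c) (sym ∣p∣≡3))) }
  where
  abc⊆p : triple a b c ⊆ p
  abc⊆p x∈ with ∈-triple⁻ x∈
  ... | inj₁ refl        = sound (here refl)
  ... | inj₂ (inj₁ refl) = sound (there (here refl))
  ... | inj₂ (inj₂ refl) = sound (there (there (here refl)))
... | []                | len | _ | _ = contradiction (trans len ∣p∣≡3) λ ()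
... | _ ∷ []            | len | _ | _ = contradiction (trans len ∣p∣≡3) λ ()
... | _ ∷ _ ∷ []        | len | _ | _ = contradiction (trans len ∣p∣≡3) λ ()
... | _ ∷ _ ∷ _ ∷ _ ∷ _ | len | _ | _ = contradiction (trans len ∣p∣≡3) λ ()

module _ {n n′} (f : Fin n → Fin n′) {p : Subset n} (t : IsTriple p) where
  open IsTriple t

  tripleImage : Subset n′
  tripleImage = triple (f a) (f b) (f c)

  ∣tripleImage∣≡3 : (∀ {u v} → u ∈ p → v ∈ p → f u ≡ f v → u ≡ v) → ∣ tripleImage ∣ ≡ 3
  ∣tripleImage∣≡3 f-injectiveOn = ∣triple∣≡3
    (a≢b ∘ f-injectiveOn (∈⁺ (inj₁ refl)) (∈⁺ (inj₂ (inj₁ refl))))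
    (a≢c ∘ f-injectiveOn (∈⁺ (inj₁ refl)) (∈⁺ (inj₂ (inj₂ refl))))
    (b≢c ∘ f-injectiveOn (∈⁺ (inj₂ (inj₁ refl))) (∈⁺ (inj₂ (inj₂ refl))))

  tripleImage-preimage : ∀ {u′} → u′ ∈ tripleImage → ∃ λ u → u ∈ p × f u ≡ u′
  tripleImage-preimage u′∈ with ∈-triple⁻ u′∈
  ... | inj₁ refl        = a , ∈⁺ (inj₁ refl) , refl
  ... | inj₂ (inj₁ refl) = b , ∈⁺ (inj₂ (inj₁ refl)) , refl
  ... | inj₂ (inj₂ refl) = c , ∈⁺ (inj₂ (inj₂ refl)) , refl

pairsOf : Fin n → Fin n → Fin n → List (Subset n)
pairsOf a b c = pair a b ∷ pair a c ∷ pair b c ∷ []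

pair∈pairsOf : ∀ {u v a b c : Fin n} → u ≢ v → u ∈ triple a b c → v ∈ triple a b c → pair u v ∈ₗ pairsOf a b c
pair∈pairsOf u≢v u∈ v∈ with ∈-triple⁻ u∈ | ∈-triple⁻ v∈
... | inj₁ refl        | inj₁ refl        = contradiction refl u≢v
... | inj₁ refl        | inj₂ (inj₁ refl) = here refl
... | inj₁ refl        | inj₂ (inj₂ refl) = there (here refl)
... | inj₂ (inj₁ refl) | inj₁ refl        = here (pair-comm _ _)
... | inj₂ (inj₁ refl) | inj₂ (inj₁ refl) = contradiction refl u≢v
... | inj₂ (inj₁ refl) | inj₂ (inj₂ refl) = there (there (here refl))
... | inj₂ (inj₂ refl) | inj₁ refl        = there (here (pair-comm _ _))
... | inj₂ (inj₂ refl) | inj₂ (inj₁ refl) = there (there (here (pair-comm _ _)))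
... | inj₂ (inj₂ refl) | inj₂ (inj₂ refl) = contradiction refl u≢v

module _ (H : BiHypergraph3 n m) where

  edgeTriple : ∀ i → IsTriple (edge H i)
  edgeTriple i = ∣p∣≡3⇒IsTriple (edge H i) (uniform H i)

  edgePairs : List (Fin m) → List (Subset n)
  edgePairs = concatMap λ i → let open IsTriple (edgeTriple i) in pairsOf a b c

  length-edgePairs : ∀ is → length (edgePairs is) ≡ 3 * length is
  length-edgePairs []       = refl
  length-edgePairs (i ∷ is) = trans (cong (3 +_) (length-edgePairs is)) (sym (*-suc 3 (length is)))

  pair∈edgePairs : ∀ {u v i is} → u ≢ v → u ∈ edge H i → v ∈ edge H i → i ∈ₗ is → pair u v ∈ₗ edgePairs is
  pair∈edgePairs {i = i} u≢v u∈ v∈ i∈is = ∈-concat⁺′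
    (pair∈pairsOf u≢v (subst (_ ∈_) p≡abc u∈) (subst (_ ∈_) p≡abc v∈)) (∈-map⁺ _ i∈is)
    where open IsTriple (edgeTriple i)

  Covered : Fin n → Fin n → Set
  Covered u v = ∃ λ i → u ∈ edge H i × v ∈ edge H i

  covered? : ∀ u v → Dec (Covered u v)
  covered? u v = any? λ i → (u ∈? edge H i) ×-dec (v ∈? edge H i)

  uncoveredPair : (ps : List (Fin n × Fin n)) → All (uncurry _≢_) ps → Unique (map (uncurry pair) ps) →
    3 * m < length ps → ∃ λ u → ∃ λ v → u ≢ v × ¬ Covered u v
  uncoveredPair ps distinct unique 3m<ps with all? (uncurry covered?) ps
  ... | yes all-covered = contradiction (Unique∧⊆⇒length≤ unique pairs⊆edgePairs) (<⇒≱ edgePairs<pairs)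
    where
    pairs⊆edgePairs : ∀ {e} → e ∈ₗ map (uncurry pair) ps → e ∈ₗ edgePairs (allFin m)
    pairs⊆edgePairs e∈ with (u , v) , uv∈ , refl ← ∈-map⁻ (uncurry pair) e∈
                       with i , u∈ , v∈ ← All.lookup all-covered uv∈
      = pair∈edgePairs (All.lookup distinct uv∈) u∈ v∈ (∈-allFin i)
    edgePairs<pairs : length (edgePairs (allFin m)) < length (map (uncurry pair) ps)
    edgePairs<pairs rewrite length-edgePairs (allFin m) | length-tabulate {n = m} (λ i → i)
                          | length-map (uncurry pair) ps = 3m<ps
  ... | no ¬all-covered with (u , v) , uv∈ , uncovered ← find (¬All⇒Any¬ (uncurry covered?) ps ¬all-covered)
    = u , v , All.lookup distinct uv∈ , uncovered

orderedPairs : ∀ d → List (Fin d × Fin d)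
orderedPairs d = filter (uncurry _<?_) (cartesianProduct (allFin d) (allFin d))

initialPairs : ∀ d k → List (Fin (d + k) × Fin (d + k))
initialPairs d k = map (Product.map (_↑ˡ k) (_↑ˡ k)) (orderedPairs d)

initialPairs-distinct : ∀ d k → All (uncurry _≢_) (initialPairs d k)
initialPairs-distinct d k = All.tabulate distinct
  where
  distinct : ∀ {u v} → (u , v) ∈ₗ initialPairs d k → u ≢ v
  distinct uv∈ with (i , j) , ij∈ , refl ← ∈-map⁻ (Product.map (_↑ˡ k) (_↑ˡ k)) uv∈
    = <⇒≢ᶠ (proj₂ (∈-filter⁻ (uncurry _<?_) {xs = cartesianProduct (allFin d) (allFin d)} ij∈)) ∘ ↑ˡ-injective k i j

-- Only the first d coordinates of these pair sets can differ, so for concrete d the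
-- side condition is closed by evaluation, uniformly in k.
initialPairSets-unique : ∀ d k →
  {_ : True (DecUnique.unique? (≡-dec _≟ᵇ_) (map (take d) (map (uncurry pair) (initialPairs d k))))} →
  Unique (map (uncurry pair) (initialPairs d k))
initialPairSets-unique d k {decided} = map⁻ (toWitness decided)

-- The fifteen 3-sets {0, i, j} with 1 ≤ i < j ≤ 6.
triplesThroughZero : ∀ k → List (Subset (7 + k))
triplesThroughZero k = map (inside ∷_) (map (uncurry pair) (initialPairs 6 k))

triplesThroughZero-unique : ∀ k → Unique (triplesThroughZero k)
triplesThroughZero-unique k = map⁺ (∷-injectiveʳ {x = inside} {y = inside}) (initialPairSets-unique 6 k)

triplesThroughZero-triples : ∀ k → All (λ e → ∣ e ∣ ≡ 3) (triplesThroughZero k)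
triplesThroughZero-triples k = All.tabulate card
  where
  card : ∀ {e} → e ∈ₗ triplesThroughZero k → ∣ e ∣ ≡ 3
  card e∈ with p , p∈ , refl ← ∈-map⁻ (inside ∷_) e∈
          with (u , v) , uv∈ , refl ← ∈-map⁻ (uncurry pair) p∈
    = cong suc (∣pair∣≡2 (All.lookup (initialPairs-distinct 6 k) uv∈))

module _ {w x : Fin (suc n)} (w≢x : w ≢ x) where

  merge : Fin (suc n) → Fin n
  merge u with u ≟ᶠ x
  ... | yes _   = punchOut (w≢x ∘ sym)
  ... | no  u≢x = punchOut (u≢x ∘ sym)

  merge-collision : ∀ {u v} → merge u ≡ merge v → u ≡ v ⊎ (u ≡ w × v ≡ x) ⊎ (u ≡ x × v ≡ w)
  merge-collision {u} {v} eq with u ≟ᶠ x | v ≟ᶠ x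
  ... | yes refl | yes refl = inj₁ refl
  ... | yes refl | no  _    = inj₂ (inj₂ (refl , sym (punchOut-injective {i = x} _ _ eq)))
  ... | no  _    | yes refl = inj₂ (inj₁ (punchOut-injective {i = x} _ _ eq , refl))
  ... | no  _    | no  _    = inj₁ (punchOut-injective {i = x} _ _ eq)

  merge-injectiveOn : ∀ {e : Subset (suc n)} → ¬ (w ∈ e × x ∈ e) →
    ∀ {u v} → u ∈ e → v ∈ e → merge u ≡ merge v → u ≡ v
  merge-injectiveOn ¬wx∈e u∈ v∈ eq with merge-collision eq
  ... | inj₁ u≡v                  = u≡v
  ... | inj₂ (inj₁ (refl , refl)) = contradiction (u∈ , v∈) ¬wx∈e
  ... | inj₂ (inj₂ (refl , refl)) = contradiction (v∈ , u∈) ¬wx∈e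

hypergraphContaining : ∀ {pool : List (Subset n)} → Unique pool → All (λ e → ∣ e ∣ ≡ 3) pool → m ≤ length pool →
  (es : Fin m → Subset n) → (∀ i → ∣ es i ∣ ≡ 3) →
  Σ (BiHypergraph3 n m) λ H → ∀ i → ∃ λ j → edge H j ≡ es i
hypergraphContaining pool-unique pool-triples m≤pool es es-triples
  with f , f-injective , f-triples , f-onto ←
       injectiveFamily (≡-dec _≟ᵇ_) pool-unique pool-triples (tabulate⁺ es-triples)
                       (≤-reflexive (length-tabulate es)) m≤pool
  = record { edge = f ; uniform = f-triples ; sperner = f-sperner } , f-onto ∘ ∈-tabulate⁺
  where
  f-sperner : ∀ i j → i ≢ j → ¬ (f i ⊆ f j)
  f-sperner i j i≢j fi⊆fj = i≢j (f-injective (⊆∧∣≡∣⇒≡ fi⊆fj (trans (f-triples i) (sym (f-triples j)))))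

NonConstantOn-pullback : ∀ {n n′} {g : Fin n′ → ℕ} {π : Fin n → Fin n′} {e e′} →
  (∀ {u′} → u′ ∈ e′ → ∃ λ u → u ∈ e × π u ≡ u′) → NonConstantOn g e′ → NonConstantOn (g ∘ π) e
NonConstantOn-pullback onto (u′ , v′ , u′∈ , v′∈ , gu′≢gv′)
  with u , u∈ , refl ← onto u′∈ | v , v∈ , refl ← onto v′∈
  = u , v , u∈ , v∈ , gu′≢gv′

NonInjectiveOn-pullback : ∀ {n n′} {g : Fin n′ → ℕ} {π : Fin n → Fin n′} {e e′} →
  (∀ {u′} → u′ ∈ e′ → ∃ λ u → u ∈ e × π u ≡ u′) → NonInjectiveOn g e′ → NonInjectiveOn (g ∘ π) e
NonInjectiveOn-pullback onto (u′ , v′ , u′∈ , v′∈ , u′≢v′ , gu′≡gv′)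
  with u , u∈ , refl ← onto u′∈ | v , v∈ , refl ← onto v′∈
  = u , v , u∈ , v∈ , u′≢v′ ∘ cong _ , gu′≡gv′

colorable-pullback : ∀ {n n′ m m′} (H : BiHypergraph3 n m) (H′ : BiHypergraph3 n′ m′) (π : Fin n → Fin n′) →
  (∀ i → ∃ λ j → ∀ {u′} → u′ ∈ edge H′ j → ∃ λ u → u ∈ edge H i × π u ≡ u′) →
  Colorable H′ → Colorable H
colorable-pullback H H′ π covered (g , g-proper) = g ∘ π , proper
  where
  proper : ProperColoring H (g ∘ π)
  proper i with j , onto ← covered i with nonConstant , nonInjective ← g-proper j
    = NonConstantOn-pullback onto nonConstant , NonInjectiveOn-pullback onto nonInjective

mergeUncoveredPair : ∀ (H : BiHypergraph3 (suc n) m) {w x} → w ≢ x → ¬ Covered H w x →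
  ∀ {pool} → Unique pool → All (λ e → ∣ e ∣ ≡ 3) pool → m ≤ length pool →
  Σ (BiHypergraph3 n m) λ H′ → Colorable H′ → Colorable H
mergeUncoveredPair H w≢x uncovered pool-unique pool-triples m≤pool =
  let H′ , contains = hypergraphContaining pool-unique pool-triples m≤pool image image-triples
  in H′ , colorable-pullback H H′ π λ i → let j , edge≡image = contains i in
            j , tripleImage-preimage π (edgeTriple H i) ∘ subst (_ ∈_) edge≡image
  where
  π = merge w≢x
  image : Fin _ → Subset _
  image i = tripleImage π (edgeTriple H i)
  image-triples : ∀ i → ∣ image i ∣ ≡ 3
  image-triples i = ∣tripleImage∣≡3 π (edgeTriple H i) (merge-injectiveOn w≢x λ (w∈ , x∈) → uncovered (i , w∈ , x∈))

corollary3p1 : (n m : ℕ) → 1 ≤ n → 1 ≤ m → 7 ≤ n → m ≤ 9 →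
    ((H : BiHypergraph3 n m) → Colorable H) →
    (H : BiHypergraph3 (suc n) m) → Colorable H
corollary3p1 n m _ _ 7≤n m≤9 colorable H
  with k , refl ← m≤n⇒∃[o]m+o≡n 7≤n
  = let w , x , w≢x , uncovered = uncoveredPair H (initialPairs 8 k) (initialPairs-distinct 8 k)
                                    (initialPairSets-unique 8 k) (s≤s (*-monoʳ-≤ 3 m≤9))
        H′ , colorable⇒colorable = mergeUncoveredPair H w≢x uncovered
                                     (triplesThroughZero-unique k) (triplesThroughZero-triples k) (≤-trans m≤9 (m≤m+n 9 6))
    in colorable⇒colorable (colorable H′)
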